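{- Fix $t\ge2$. For $n\ge1$ let $G_n^{(t)}$ be the $t$-uniform hypergraph on $\{1,\ldots,n\}$ whose hyperedges are the $t$-element pairwise coprime subsets. Let $c\ge1$ and $k_1,\ldots,k_c\ge t$. Let $R^{(t)}_{\mathrm{cl}}(k_1,\ldots,k_c)$ be the classical $t$-uniform hypergraph Ramsey number: the least $N$ such that every coloring of the $t$-subsets of an $N$-set with colors $1,\ldots,c$ has, for some $i$, a $k_i$-subset all of whose $t$-subsets have color $i$. Let $R^{(t)\text{ -edge}}_{\mathrm{cop}}(k_1,\ldots,k_c)$ be the least $n$ such that every coloring of the hyperedges of $G_n^{(t)}$ with colors $1,\ldots,c$ has, for some $i$, a set of $k_i$ vertices all of whose $t$-subsets are hyperedges of color $i$. Then \[ R^{(t)\text{ -edge}}_{\mathrm{cop}}(k_1,\ldots,k_c)=p_{R^{(t)}_{\mathrm{cl}}(k_1,\ldots,k_c)-1}, \] where $p_m$ is the $m$-th prime ($p_1=2$).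
   Context: A pairwise coprime set is a set of distinct positive integers any two of which are coprime. -}

module Defs where

open import Data.Nat using (ℕ; suc; _≤_; _∸_)
open import Data.Nat.Primality using (Prime; prime?)
open import Data.Nat.Coprimality using (Coprime)
open import Data.Fin using (Fin; toℕ)
open import Data.Fin.Subset using (Subset; _∈_; _⊆_; ∣_∣)
open import Data.List using (length; filter; upTo)
open import Data.Product using (_×_; ∃-syntax)
open import Relation.Binary.PropositionalEquality using (_≡_; _≢_)

IsLeast : (ℕ → Set) → ℕ → Set
IsLeast P n = P n × (∀ m → P m → n ≤ m)

NthPrime : ℕ → ℕ → Set
NthPrime m q = Prime q × length (filter prime? (upTo (suc q))) ≡ m

-- Classical Ramsey property on the N-set Fin N.  A colouring of the t-subsets
-- is given as a function on all subsets (only values on t-subsets matter).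
ClassicalArrows : (t c : ℕ) → (Fin c → ℕ) → ℕ → Set
ClassicalArrows t c k N =
  (χ : Subset N → Fin c) →
  ∃[ i ] ∃[ S ] (∣ S ∣ ≡ k i ×
    (∀ (T : Subset N) → T ⊆ S → ∣ T ∣ ≡ t → χ T ≡ i))

-- Vertex x : Fin n stands for the integer toℕ x + 1 ∈ {1,…,n}.
PairwiseCoprime : {n : ℕ} → Subset n → Set
PairwiseCoprime {n} T =
  ∀ (x y : Fin n) → x ∈ T → y ∈ T → x ≢ y → Coprime (suc (toℕ x)) (suc (toℕ y))

IsHyperedge : (t n : ℕ) → Subset n → Set
IsHyperedge t n T = ∣ T ∣ ≡ t × PairwiseCoprime T

-- Coprime edge-Ramsey property for G_n^(t) (n ≥ 1).  A colouring of the
-- hyperedges is given as a function on all subsets (only hyperedge values matter).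
CoprimeArrows : (t c : ℕ) → (Fin c → ℕ) → ℕ → Set
CoprimeArrows t c k n =
  1 ≤ n ×
  ((χ : Subset n → Fin c) →
   ∃[ i ] ∃[ S ] (∣ S ∣ ≡ k i ×
     (∀ (T : Subset n) → T ⊆ S → ∣ T ∣ ≡ t → IsHyperedge t n T × χ T ≡ i)))

{-# OPTIONS --safe #-}
module Submission where

-- The vertex 1 and the π(q) primes up to q are N = 1 + π(q) pairwise coprime vertices of G_q,
-- so a colouring of G_q restricts to a colouring of the t-subsets of an N-set, whose
-- monochromatic k_i-set is then a monochromatic set of hyperedges.  Conversely, for m < q send
-- the vertex 1 of G_m to 0 and every other vertex to the position of one of its prime factors
-- among the π(q) − 1 primes below q.  As t ≥ 2, a k_i-set all of whose t-subsets are hyperedges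
-- is pairwise coprime, and on such a set the map is injective; so a colouring of the t-subsets
-- of a π(q)-set pulls back to G_m, and if m worked then π(q) < N would work classically.

open import Defs
open import Data.Nat using (ℕ; suc; _+_; _≤_; _<_; _∸_; z≤n; s≤s; s≤s⁻¹; _≤?_; NonZero; >-nonZero⁻¹)
open import Data.Nat.Properties
  using (≤-trans; ≤-antisym; ≤-reflexive; ≤-<-trans; ≰⇒>; ≮⇒≥; 1+n≰n; m+[n∸m]≡n; +-comm; *-comm)
open import Data.Nat.Divisibility using (_∣_; divides; ∣⇒≤)
open import Data.Nat.Primality using (Prime; prime?; ¬prime[1]; prime⇒irreducible; prime⇒nonZero)
open import Data.Nat.Primality.Factorisation using (factorise)
open import Data.Nat.Coprimality using (Coprime; 1-coprimeTo)
import Data.Nat.Coprimality as Coprime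
open import Data.Nat.ListAction using (product)
open import Data.Fin using (Fin; zero; suc; toℕ; fromℕ<; _≟_)
open import Data.Fin.Properties using (toℕ-fromℕ<; toℕ<n; suc-injective)
open import Data.Fin.Subset using (Subset; inside; outside; _∈_; _∉_; _⊆_; ∣_∣; ⊥; ⁅_⁆; _∪_; _∩_)
open import Data.Fin.Subset.Properties
  using ( ⊆-refl; ⊆-antisym; drop-∷-⊆; s⊆s; out⊆; ∉⊥; ∣⊥∣≡0; ∣p∣≤n; x∈⁅x⁆; x∈⁅y⁆⇒x≡y; x≢y⇒x∉⁅y⁆
        ; ∣⁅x⁆∣≡1; ∪-identityˡ; x∈p∪q⁺; x∈p∪q⁻; x∈p∩q⁺; x∈p∩q⁻; p∩q⊆p)
open import Data.List using (List; []; _∷_; length; filter; upTo; lookup; _++_)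
open import Data.List.Properties using (upTo-∷ʳ; filter-++; filter-accept; length-++)
open import Data.List.Membership.Propositional using () renaming (_∈_ to _∈ₗ_)
open import Data.List.Membership.Propositional.Properties
  using (∈-filter⁺; ∈-filter⁻; ∈-upTo⁺; ∈-upTo⁻; ∈-lookup)
open import Data.List.Membership.Setoid.Properties using (index-injective)
open import Data.List.Relation.Unary.Any using (index)
open import Data.List.Relation.Unary.All using (_∷_)
import Data.List.Relation.Unary.All as All
open import Data.List.Relation.Unary.AllPairs using (_∷_)
open import Data.List.Relation.Unary.Unique.Propositional using (Unique)
open import Data.List.Relation.Unary.Unique.Propositional.Properties using (upTo⁺; filter⁺)
open import Data.Vec using ([]; _∷_; tabulate; here; there)
import Data.Vec as Vec
open import Data.Vec.Properties using (lookup⇒[]=; []=⇒lookup; lookup∘tabulate)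
open import Data.Product using (∃-syntax; _×_; _,_; proj₁; proj₂; map; map₁)
open import Data.Sum using (inj₁; inj₂; [_,_])
open import Function using (_∘_)
open import Function.Definitions using (Injective)
open import Relation.Nullary using (yes; no; contradiction)
open import Relation.Nullary.Decidable using (decidable-stable)
open import Relation.Binary.PropositionalEquality
  using (_≡_; _≢_; refl; sym; trans; cong; subst; subst₂; setoid; module ≡-Reasoning)

private variable
  a b n m t : ℕ

-- Subsets of Fin n

⁅x⁆⊆p : ∀ {x : Fin n} {p} → x ∈ p → ⁅ x ⁆ ⊆ p
⁅x⁆⊆p x∈p y∈⁅x⁆ = subst (_∈ _) (sym (x∈⁅y⁆⇒x≡y _ y∈⁅x⁆)) x∈p

p∪q⊆r : ∀ {p q r : Subset n} → p ⊆ r → q ⊆ r → p ∪ q ⊆ r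
p∪q⊆r {p = p} {q} p⊆r q⊆r x∈p∪q = [ p⊆r , q⊆r ] (x∈p∪q⁻ p q x∈p∪q)

∣⁅x⁆∪p∣≡1+∣p∣ : ∀ {x : Fin n} {p} → x ∉ p → ∣ ⁅ x ⁆ ∪ p ∣ ≡ suc ∣ p ∣
∣⁅x⁆∪p∣≡1+∣p∣ {x = zero}  {inside  ∷ p} x∉p = contradiction here x∉p
∣⁅x⁆∪p∣≡1+∣p∣ {x = zero}  {outside ∷ p} _   = cong (suc ∘ ∣_∣) (∪-identityˡ p)
∣⁅x⁆∪p∣≡1+∣p∣ {x = suc x} {inside  ∷ p} x∉p = cong suc (∣⁅x⁆∪p∣≡1+∣p∣ (x∉p ∘ there))
∣⁅x⁆∪p∣≡1+∣p∣ {x = suc x} {outside ∷ p} x∉p = ∣⁅x⁆∪p∣≡1+∣p∣ (x∉p ∘ there)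

extendWithin : ∀ {A S : Subset n} → A ⊆ S → ∣ A ∣ ≤ m → m ≤ ∣ S ∣ →
               ∃[ B ] A ⊆ B × B ⊆ S × ∣ B ∣ ≡ m
extendWithin {A = []} {[]} _ _ z≤n = [] , ⊆-refl , ⊆-refl , refl
extendWithin {A = inside ∷ _} {outside ∷ _} A⊆S _ _ = contradiction (A⊆S here) λ ()
extendWithin {A = inside ∷ _} {inside ∷ _} A⊆S (s≤s ∣A∣≤m) (s≤s m≤∣S∣) =
  let B , A⊆B , B⊆S , ∣B∣≡m = extendWithin (drop-∷-⊆ A⊆S) ∣A∣≤m m≤∣S∣
  in  inside ∷ B , s⊆s A⊆B , s⊆s B⊆S , cong suc ∣B∣≡m
extendWithin {A = outside ∷ _} {outside ∷ _} A⊆S ∣A∣≤m m≤∣S∣ =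
  let B , A⊆B , B⊆S , ∣B∣≡m = extendWithin (drop-∷-⊆ A⊆S) ∣A∣≤m m≤∣S∣
  in  outside ∷ B , s⊆s A⊆B , s⊆s B⊆S , ∣B∣≡m
extendWithin {m = m} {A = outside ∷ _} {inside ∷ S} A⊆S ∣A∣≤m m≤1+∣S∣ with m ≤? ∣ S ∣
... | yes m≤∣S∣ =
  let B , A⊆B , B⊆S , ∣B∣≡m = extendWithin (drop-∷-⊆ A⊆S) ∣A∣≤m m≤∣S∣
  in  outside ∷ B , s⊆s A⊆B , out⊆ B⊆S , ∣B∣≡m
... | no m≰∣S∣ = inside ∷ S , A⊆S , ⊆-refl , ≤-antisym (≰⇒> m≰∣S∣) m≤1+∣S∣

extendPairWithin : ∀ {S : Subset n} {x y} → x ∈ S → y ∈ S → x ≢ y → 2 ≤ t → t ≤ ∣ S ∣ →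
                   ∃[ T ] T ⊆ S × ∣ T ∣ ≡ t × x ∈ T × y ∈ T
extendPairWithin {x = x} {y} x∈S y∈S x≢y 2≤t t≤∣S∣ =
  let T , pair⊆T , T⊆S , ∣T∣≡t = extendWithin pair⊆S (≤-trans (≤-reflexive ∣pair∣≡2) 2≤t) t≤∣S∣
  in  T , T⊆S , ∣T∣≡t , pair⊆T (x∈p∪q⁺ (inj₁ (x∈⁅x⁆ x))) , pair⊆T (x∈p∪q⁺ (inj₂ (x∈⁅x⁆ y)))
  where
  pair⊆S = p∪q⊆r (⁅x⁆⊆p x∈S) (⁅x⁆⊆p y∈S)
  ∣pair∣≡2 : ∣ ⁅ x ⁆ ∪ ⁅ y ⁆ ∣ ≡ 2
  ∣pair∣≡2 = trans (∣⁅x⁆∪p∣≡1+∣p∣ (x≢y⇒x∉⁅y⁆ x≢y)) (cong suc (∣⁅x⁆∣≡1 y))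

-- Images of subsets

InjectiveOn : (Fin a → Fin b) → Subset a → Set
InjectiveOn f S = ∀ {x y} → x ∈ S → y ∈ S → f x ≡ f y → x ≡ y

injectiveOn-⊆ : ∀ {f : Fin a → Fin b} {S T} → T ⊆ S → InjectiveOn f S → InjectiveOn f T
injectiveOn-⊆ T⊆S inj x∈T y∈T = inj (T⊆S x∈T) (T⊆S y∈T)

injectiveOn-tail : ∀ {f : Fin (suc a) → Fin b} {s S} → InjectiveOn f (s ∷ S) → InjectiveOn (f ∘ suc) S
injectiveOn-tail inj x∈S y∈S fx≡fy = suc-injective (inj (there x∈S) (there y∈S) fx≡fy)

image : (Fin a → Fin b) → Subset a → Subset b
image f []            = ⊥
image f (inside  ∷ S) = ⁅ f zero ⁆ ∪ image (f ∘ suc) S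
image f (outside ∷ S) = image (f ∘ suc) S

∈-image⁺ : ∀ (f : Fin a → Fin b) {S x} → x ∈ S → f x ∈ image f S
∈-image⁺ f {inside  ∷ _} here        = x∈p∪q⁺ (inj₁ (x∈⁅x⁆ (f zero)))
∈-image⁺ f {inside  ∷ _} (there x∈S) = x∈p∪q⁺ (inj₂ (∈-image⁺ (f ∘ suc) x∈S))
∈-image⁺ f {outside ∷ _} (there x∈S) = ∈-image⁺ (f ∘ suc) x∈S

∈-image⁻ : ∀ (f : Fin a → Fin b) S {y} → y ∈ image f S → ∃[ x ] x ∈ S × f x ≡ y
∈-image⁻ f []            y∈ = contradiction y∈ ∉⊥
∈-image⁻ f (inside  ∷ S) y∈ with x∈p∪q⁻ ⁅ f zero ⁆ _ y∈
... | inj₁ y∈⁅f0⁆  = zero , here , sym (x∈⁅y⁆⇒x≡y _ y∈⁅f0⁆)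
... | inj₂ y∈image = map suc (map₁ there) (∈-image⁻ (f ∘ suc) S y∈image)
∈-image⁻ f (outside ∷ S) y∈ = map suc (map₁ there) (∈-image⁻ (f ∘ suc) S y∈)

∣image∣≡∣S∣ : ∀ (f : Fin a → Fin b) S → InjectiveOn f S → ∣ image f S ∣ ≡ ∣ S ∣
∣image∣≡∣S∣ {b = b} f []      _ = ∣⊥∣≡0 b
∣image∣≡∣S∣ f (inside  ∷ S) inj =
  trans (∣⁅x⁆∪p∣≡1+∣p∣ f0∉image) (cong suc (∣image∣≡∣S∣ (f ∘ suc) S (injectiveOn-tail inj)))
  where
  f0∉image : f zero ∉ image (f ∘ suc) S
  f0∉image f0∈ with _ , x∈S , fx≡f0 ← ∈-image⁻ (f ∘ suc) S f0∈ with () ← inj (there x∈S) here fx≡f0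
∣image∣≡∣S∣ f (outside ∷ S) inj = ∣image∣≡∣S∣ (f ∘ suc) S (injectiveOn-tail inj)

preimage : (Fin a → Fin b) → Subset b → Subset a
preimage f T = tabulate (Vec.lookup T ∘ f)

∈-preimage⁺ : ∀ {f : Fin a → Fin b} {T x} → f x ∈ T → x ∈ preimage f T
∈-preimage⁺ {f = f} {T} {x} fx∈T =
  lookup⇒[]= x _ (trans (lookup∘tabulate (Vec.lookup T ∘ f) x) ([]=⇒lookup fx∈T))

∈-preimage⁻ : ∀ {f : Fin a → Fin b} {T x} → x ∈ preimage f T → f x ∈ T
∈-preimage⁻ {f = f} {T} {x} x∈ =
  lookup⇒[]= (f x) T (trans (sym (lookup∘tabulate (Vec.lookup T ∘ f) x)) ([]=⇒lookup x∈))

image-∩-preimage : ∀ (f : Fin a → Fin b) S {T} → T ⊆ image f S → image f (S ∩ preimage f T) ≡ T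
image-∩-preimage f S {T} T⊆image = ⊆-antisym image⊆T T⊆image′
  where
  image⊆T : image f (S ∩ preimage f T) ⊆ T
  image⊆T y∈ with _ , x∈ , refl ← ∈-image⁻ f (S ∩ preimage f T) y∈ =
    ∈-preimage⁻ {f = f} (proj₂ (x∈p∩q⁻ S _ x∈))
  T⊆image′ : T ⊆ image f (S ∩ preimage f T)
  T⊆image′ y∈T with _ , x∈S , refl ← ∈-image⁻ f S (T⊆image y∈T) =
    ∈-image⁺ f (x∈p∩q⁺ (x∈S , ∈-preimage⁺ y∈T))

Monochromatic : {C : Set} → ℕ → (Subset n → C) → C → Subset n → Set
Monochromatic t χ i S = ∀ T → T ⊆ S → ∣ T ∣ ≡ t → χ T ≡ i

monochromatic-image : ∀ {C : Set} (f : Fin a → Fin b) (χ : Subset b → C) {i S} → InjectiveOn f S →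
                      Monochromatic t (χ ∘ image f) i S → Monochromatic t χ i (image f S)
monochromatic-image {t = t} f χ {i} {S} inj mono T T⊆image ∣T∣≡t =
  subst (λ U → χ U ≡ i) image-T₀≡T (mono T₀ (p∩q⊆p S _) ∣T₀∣≡t)
  where
  open ≡-Reasoning
  T₀ = S ∩ preimage f T
  image-T₀≡T = image-∩-preimage f S T⊆image
  ∣T₀∣≡t : ∣ T₀ ∣ ≡ t
  ∣T₀∣≡t = begin
    ∣ T₀ ∣          ≡⟨ ∣image∣≡∣S∣ f T₀ (injectiveOn-⊆ (p∩q⊆p S _) inj) ⟨
    ∣ image f T₀ ∣  ≡⟨ cong ∣_∣ image-T₀≡T ⟩
    ∣ T ∣           ≡⟨ ∣T∣≡t ⟩
    t               ∎

-- Transferring the Ramsey property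

CoprimeVertices : Fin n → Fin n → Set
CoprimeVertices x y = Coprime (suc (toℕ x)) (suc (toℕ y))

pairwiseCoprime-⊆ : ∀ {S T : Subset n} → T ⊆ S → PairwiseCoprime S → PairwiseCoprime T
pairwiseCoprime-⊆ T⊆S cop x y x∈T y∈T = cop x y (T⊆S x∈T) (T⊆S y∈T)

pairwiseCoprime-image : ∀ (g : Fin a → Fin b) → (∀ {x y} → x ≢ y → CoprimeVertices (g x) (g y)) →
                        ∀ S → PairwiseCoprime (image g S)
pairwiseCoprime-image g g-cop S u v u∈ v∈ u≢v
  with _ , _ , refl ← ∈-image⁻ g S u∈ | _ , _ , refl ← ∈-image⁻ g S v∈ = g-cop (u≢v ∘ cong g)

pairwiseCoprime-fromSubsets : ∀ {S : Subset n} → 2 ≤ t → t ≤ ∣ S ∣ →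
                              (∀ T → T ⊆ S → ∣ T ∣ ≡ t → PairwiseCoprime T) → PairwiseCoprime S
pairwiseCoprime-fromSubsets 2≤t t≤∣S∣ cop x y x∈S y∈S x≢y =
  let T , T⊆S , ∣T∣≡t , x∈T , y∈T = extendPairWithin x∈S y∈S x≢y 2≤t t≤∣S∣
  in  cop T T⊆S ∣T∣≡t x y x∈T y∈T x≢y

classicalArrows⇒coprimeArrows : ∀ {c k N} → 1 ≤ n → (g : Fin N → Fin n) → Injective _≡_ _≡_ g →
                                (∀ {x y} → x ≢ y → CoprimeVertices (g x) (g y)) →
                                ClassicalArrows t c k N → CoprimeArrows t c k n
classicalArrows⇒coprimeArrows 1≤n g g-inj g-cop arrows = 1≤n , λ χ →
  let i , S , ∣S∣≡k , mono = arrows (χ ∘ image g)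
      inj : InjectiveOn g S
      inj _ _ = g-inj
  in  i , image g S , trans (∣image∣≡∣S∣ g S inj) ∣S∣≡k , λ T T⊆image ∣T∣≡t →
      (∣T∣≡t , pairwiseCoprime-⊆ T⊆image (pairwiseCoprime-image g g-cop S)) ,
      monochromatic-image g χ inj mono T T⊆image ∣T∣≡t

coprimeArrows⇒classicalArrows : ∀ {c k M} → 2 ≤ t → (∀ i → t ≤ k i) → (f : Fin m → Fin M) →
                                (∀ {x y} → x ≢ y → CoprimeVertices x y → f x ≢ f y) →
                                CoprimeArrows t c k m → ClassicalArrows t c k M
coprimeArrows⇒classicalArrows {t = t} 2≤t t≤k f f-sep (_ , arrows) χ =
  let i , S , ∣S∣≡k , hyp = arrows (χ ∘ image f)
      S-cop : PairwiseCoprime S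
      S-cop = pairwiseCoprime-fromSubsets 2≤t (subst (t ≤_) (sym ∣S∣≡k) (t≤k i))
                λ T T⊆S ∣T∣≡t → proj₂ (proj₁ (hyp T T⊆S ∣T∣≡t))
      inj : InjectiveOn f S
      inj {x} {y} x∈S y∈S fx≡fy =
        decidable-stable (x ≟ y) λ x≢y → f-sep x≢y (S-cop x y x∈S y∈S x≢y) fx≡fy
  in  i , image f S , trans (∣image∣≡∣S∣ f S inj) ∣S∣≡k ,
      monochromatic-image f χ inj λ T T⊆S ∣T∣≡t → proj₂ (hyp T T⊆S ∣T∣≡t)

classicalArrows⇒∃k≤N : ∀ {c k N} → Fin c → ClassicalArrows t c k N → ∃[ i ] k i ≤ N
classicalArrows⇒∃k≤N colour arrows =
  let i , S , ∣S∣≡k , _ = arrows (λ _ → colour)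
  in  i , subst (_≤ _) ∣S∣≡k (∣p∣≤n S)

-- Primes

lookup-injective : ∀ {A : Set} {xs : List A} → Unique xs → ∀ {i j} → lookup xs i ≡ lookup xs j → i ≡ j
lookup-injective (_  ∷ _)    {zero}  {zero}  _  = refl
lookup-injective (x∉ ∷ _)    {zero}  {suc j} eq = contradiction eq (All.lookup x∉ (∈-lookup j))
lookup-injective (x∉ ∷ _)    {suc i} {zero}  eq = contradiction (sym eq) (All.lookup x∉ (∈-lookup i))
lookup-injective (_  ∷ uniq) {suc i} {suc j} eq = cong suc (lookup-injective uniq eq)

coprime-primes : ∀ {p q} → Prime p → Prime q → p ≢ q → Coprime p q
coprime-primes p-prime q-prime p≢q (d∣p , d∣q)
  with prime⇒irreducible p-prime d∣p | prime⇒irreducible q-prime d∣q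
... | inj₁ d≡1 | _        = d≡1
... | inj₂ _   | inj₁ d≡1 = d≡1
... | inj₂ d≡p | inj₂ d≡q = contradiction (trans (sym d≡p) d≡q) p≢q

primeDivisor : ∀ k → ∃[ p ] Prime p × p ∣ 2 + k
primeDivisor k with factorise (2 + k)
... | record { factors = [] ; isFactorisation = () }
... | record { factors = p ∷ ps ; isFactorisation = 2+k≡p*∏ps ; factorsPrime = p-prime ∷ _ } =
  p , p-prime , divides (product ps) (trans 2+k≡p*∏ps (*-comm p (product ps)))

primesBelow : ℕ → List ℕ
primesBelow n = filter prime? (upTo n)

π : ℕ → ℕ
π n = length (primesBelow (suc n))

∈-primesBelow⁺ : ∀ {p} → Prime p → p < n → p ∈ₗ primesBelow n
∈-primesBelow⁺ p-prime p<n = ∈-filter⁺ prime? (∈-upTo⁺ p<n) p-prime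

∈-primesBelow⁻ : ∀ {p} → p ∈ₗ primesBelow n → Prime p × p < n
∈-primesBelow⁻ {n} p∈ =
  let p∈upTo , p-prime = ∈-filter⁻ prime? {xs = upTo n} p∈
  in  p-prime , ∈-upTo⁻ p∈upTo

primesBelow-unique : ∀ n → Unique (primesBelow n)
primesBelow-unique n = filter⁺ prime? (upTo⁺ n)

π-prime : Prime n → π n ≡ suc (length (primesBelow n))
π-prime {n} n-prime = begin
  length (filter prime? (upTo (suc n)))             ≡⟨ cong (length ∘ filter prime?) (upTo-∷ʳ n) ⟨
  length (filter prime? (upTo n ++ n ∷ []))         ≡⟨ cong length (filter-++ prime? (upTo n) (n ∷ [])) ⟩
  length (primesBelow n ++ filter prime? (n ∷ []))  ≡⟨ cong (length ∘ (primesBelow n ++_))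
                                                             (filter-accept prime? n-prime) ⟩
  length (primesBelow n ++ n ∷ [])                  ≡⟨ length-++ (primesBelow n) ⟩
  length (primesBelow n) + 1                        ≡⟨ +-comm (length (primesBelow n)) 1 ⟩
  suc (length (primesBelow n))                      ∎
  where open ≡-Reasoning

toVertex : ∀ v .{{_ : NonZero v}} → v ≤ n → Fin n
toVertex (suc v) v<n = fromℕ< v<n

toℕ-toVertex : ∀ v .{{_ : NonZero v}} (v≤n : v ≤ n) → suc (toℕ (toVertex v v≤n)) ≡ v
toℕ-toVertex (suc v) v<n = cong suc (toℕ-fromℕ< v<n)

oneOrPrime : ∀ n → Fin (suc (π n)) → ℕ
oneOrPrime n zero    = 1
oneOrPrime n (suc j) = lookup (primesBelow (suc n)) j

oneOrPrime-prime : ∀ n j → Prime (oneOrPrime n (suc j))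
oneOrPrime-prime n j = proj₁ (∈-primesBelow⁻ {suc n} (∈-lookup j))

oneOrPrime-≤ : ∀ n j → oneOrPrime n (suc j) ≤ n
oneOrPrime-≤ n j = s≤s⁻¹ (proj₂ (∈-primesBelow⁻ {suc n} (∈-lookup j)))

oneOrPrime-injective : ∀ n → Injective _≡_ _≡_ (oneOrPrime n)
oneOrPrime-injective n {zero}  {zero}  _  = refl
oneOrPrime-injective n {zero}  {suc j} eq =
  contradiction (subst Prime (sym eq) (oneOrPrime-prime n j)) ¬prime[1]
oneOrPrime-injective n {suc i} {zero}  eq =
  contradiction (subst Prime eq (oneOrPrime-prime n i)) ¬prime[1]
oneOrPrime-injective n {suc i} {suc j} eq = cong suc (lookup-injective (primesBelow-unique (suc n)) eq)

oneOrPrime-coprime : ∀ n {a b} → a ≢ b → Coprime (oneOrPrime n a) (oneOrPrime n b)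
oneOrPrime-coprime n {zero}  {zero}  a≢b = contradiction refl a≢b
oneOrPrime-coprime n {zero}  {suc j} _   = 1-coprimeTo _
oneOrPrime-coprime n {suc i} {zero}  _   = Coprime.sym (1-coprimeTo _)
oneOrPrime-coprime n {suc i} {suc j} a≢b =
  coprime-primes (oneOrPrime-prime n i) (oneOrPrime-prime n j) (a≢b ∘ oneOrPrime-injective n)

primeVertex : 1 ≤ n → Fin (suc (π n)) → Fin n
primeVertex     1≤n zero    = toVertex 1 1≤n
primeVertex {n} _   (suc j) =
  toVertex (oneOrPrime n (suc j)) {{prime⇒nonZero (oneOrPrime-prime n j)}} (oneOrPrime-≤ n j)

toℕ-primeVertex : (1≤n : 1 ≤ n) → ∀ a → suc (toℕ (primeVertex 1≤n a)) ≡ oneOrPrime n a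
toℕ-primeVertex     1≤n zero    = toℕ-toVertex 1 1≤n
toℕ-primeVertex {n} _   (suc j) =
  toℕ-toVertex (oneOrPrime n (suc j)) {{prime⇒nonZero (oneOrPrime-prime n j)}} (oneOrPrime-≤ n j)

primeVertex-injective : (1≤n : 1 ≤ n) → Injective _≡_ _≡_ (primeVertex 1≤n)
primeVertex-injective {n} 1≤n {a} {b} eq = oneOrPrime-injective n (begin
  oneOrPrime n a                 ≡⟨ toℕ-primeVertex 1≤n a ⟨
  suc (toℕ (primeVertex 1≤n a))  ≡⟨ cong (suc ∘ toℕ) eq ⟩
  suc (toℕ (primeVertex 1≤n b))  ≡⟨ toℕ-primeVertex 1≤n b ⟩
  oneOrPrime n b                 ∎)
  where open ≡-Reasoning

primeVertex-coprime : (1≤n : 1 ≤ n) → ∀ {a b} → a ≢ b →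
                      CoprimeVertices (primeVertex 1≤n a) (primeVertex 1≤n b)
primeVertex-coprime {n} 1≤n {a} {b} a≢b =
  subst₂ Coprime (sym (toℕ-primeVertex 1≤n a)) (sym (toℕ-primeVertex 1≤n b)) (oneOrPrime-coprime n a≢b)

primeDivisor∈primesBelow : ∀ k → 2 + k < n → proj₁ (primeDivisor k) ∈ₗ primesBelow n
primeDivisor∈primesBelow k 2+k<n =
  let _ , p-prime , p∣2+k = primeDivisor k
  in  ∈-primesBelow⁺ p-prime (≤-<-trans (∣⇒≤ p∣2+k) 2+k<n)

primeFactorIndex : m < n → Fin m → Fin (suc (length (primesBelow n)))
primeFactorIndex m<n zero    = zero
primeFactorIndex m<n (suc x) =
  suc (index (primeDivisor∈primesBelow (toℕ x) (≤-<-trans (s≤s (toℕ<n x)) m<n)))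

primeFactorIndex-separates : (m<n : m < n) → ∀ {x y} → x ≢ y → CoprimeVertices x y →
                             primeFactorIndex m<n x ≢ primeFactorIndex m<n y
primeFactorIndex-separates m<n {zero}  {zero}  x≢y _ = contradiction refl x≢y
primeFactorIndex-separates m<n {zero}  {suc _} _   _ = λ ()
primeFactorIndex-separates m<n {suc _} {zero}  _   _ = λ ()
primeFactorIndex-separates m<n {suc x} {suc y} _ coprime eq =
  let p , p-prime , p∣x = primeDivisor (toℕ x)
      _ , _ , p′∣y = primeDivisor (toℕ y)
      p≡p′ = index-injective (setoid ℕ) _ _ (suc-injective eq)
  in  ¬prime[1] (subst Prime (coprime (p∣x , subst (_∣ _) (sym p≡p′) p′∣y)) p-prime)

classicalArrows⇒coprimeArrows-prime : ∀ {c k q} → Prime q →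
                                      ClassicalArrows t c k (suc (π q)) → CoprimeArrows t c k q
classicalArrows⇒coprimeArrows-prime {q = q} q-prime =
  classicalArrows⇒coprimeArrows 1≤q (primeVertex 1≤q)
    (primeVertex-injective 1≤q) (primeVertex-coprime 1≤q)
  where
  1≤q : 1 ≤ q
  1≤q = >-nonZero⁻¹ q {{prime⇒nonZero q-prime}}

coprimeArrows⇒classicalArrows-prime : ∀ {c k q} → 2 ≤ t → (∀ i → t ≤ k i) → Prime q → m < q →
                                      CoprimeArrows t c k m → ClassicalArrows t c k (π q)
coprimeArrows⇒classicalArrows-prime {t = t} {c = c} {k = k} 2≤t t≤k q-prime m<q arrows =
  subst (ClassicalArrows t c k) (sym (π-prime q-prime))
    (coprimeArrows⇒classicalArrows 2≤t t≤k
      (primeFactorIndex m<q) (primeFactorIndex-separates m<q) arrows)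

corollary4p9 : (t : ℕ) → 2 ≤ t → (c : ℕ) → 1 ≤ c → (k : Fin c → ℕ) → (∀ i → t ≤ k i) →
    (N : ℕ) → IsLeast (ClassicalArrows t c k) N →
    (q : ℕ) → NthPrime (N ∸ 1) q →
    IsLeast (CoprimeArrows t c k) q
corollary4p9 t 2≤t c 1≤c k t≤k N (arrows , least) q (q-prime , πq≡N∸1) =
  classicalArrows⇒coprimeArrows-prime q-prime (subst (ClassicalArrows t c k) N≡1+πq arrows) ,
  λ m coprimeArrows → ≮⇒≥ λ m<q →
    1+n≰n (subst (_≤ π q) N≡1+πq
      (least (π q) (coprimeArrows⇒classicalArrows-prime 2≤t t≤k q-prime m<q coprimeArrows)))
  where
  1≤N : 1 ≤ N
  1≤N = let i , kᵢ≤N = classicalArrows⇒∃k≤N (fromℕ< 1≤c) arrows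
        in  ≤-trans (≤-trans (s≤s z≤n) 2≤t) (≤-trans (t≤k i) kᵢ≤N)
  N≡1+πq : N ≡ suc (π q)
  N≡1+πq = trans (sym (m+[n∸m]≡n 1≤N)) (cong suc (sym πq≡N∸1))
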